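{- Let $v$ and $w$ be two words on the alphabet $X=\{a,b\}$. Then $v\,\Box_9\, w\neq 0$.
   Context: Let $\mathbb{K}$ be a field of characteristic 0 and let $X=\{a,b\}$ be an alphabet of cardinality 2. Denote by $X^*$ the set of words on $X$ (including the empty word $1$) and by $\mathbb{K}\langle X\rangle$ the vector space (algebra) of words on $X$. A weak shuffle product on $\mathbb{K}\langle X\rangle$ is an associative and commutative bilinear product $\Box$ such that for all letters $x,y\in X$ and all words $u,v\in X^*$: $u\Box 1=1\Box u=u$, $u\Box 0=0\Box u=0$, and $xu\,\Box\, yv=f_1(x\otimes y)\,x(u\Box yv)+f_2(x\otimes y)\,y(xu\Box v)$, where $f_1,f_2:\mathbb{K}.X\otimes\mathbb{K}.X\to\mathbb{K}$ are linear maps. Let $\Box_9$ be the weak shuffle product on $\mathbb{K}\langle\{a,b\}\rangle$ determined by $f_1(a\otimes b)=1$, $f_1(b\otimes a)=0$ (equivalently $f_2(b\otimes a)=1$, $f_2(a\otimes b)=0$), $f_1(a\otimes a)=f_2(a\otimes a)=1$ and $f_1(b\otimes b)=f_2(b\otimes b)=1$. Explicitly, for nonempty words: if $u=a^m u'$ with $u',v\in bX^*\cup\{1\}$ then $u\Box_9 v=a^m(u'\Box_9 v)$; if $u=a^k u'$, $v=a^l v'$ with $u',v'\in bX^*\cup\{1\}$ then $u\Box_9 v=\binom{k+l}{k}a^{k+l}(u'\Box_9 v')$; if $u=b^{m_1}u'$, $v=b^{m_2}v'$ with $u',v'\in aX^*\cup\{1\}$ then $u\Box_9 v=\sum_{k=0}^{m_2-1}\binom{m_1+k-1}{k}b^{m_1+k}(u'\Box_9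 b^{m_2-k}v')+\sum_{k=0}^{m_1-1}\binom{m_2+k-1}{k}b^{m_2+k}(b^{m_1-k}u'\Box_9 v')$. -}

module Defs where

open import Data.Nat using (ℕ; zero; suc; _+_; _*_)
open import Data.Product using (_×_; _,_; ∃)
open import Data.List using (List; []; _∷_; _++_; map)
open import Data.List.Properties using (≡-dec)
open import Relation.Nullary using (Dec; yes; no; ¬_)
open import Relation.Binary.PropositionalEquality using (_≡_; refl)

data Letter : Set where
  a b : Letter

_≟L_ : (x y : Letter) → Dec (x ≡ y)
a ≟L a = yes refl
a ≟L b = no (λ ())
b ≟L a = no (λ ())
b ≟L b = yes refl

Word : Set
Word = List Letter

_≟W_ : (u v : Word) → Dec (u ≡ v)
_≟W_ = ≡-dec _≟L_

-- A (finite) linear combination of words, given as a list of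
-- (coefficient, word) pairs; repeated words are summed.
-- Coefficients lie in ℕ: every structure constant of □₉ is a
-- nonnegative integer (f₁, f₂ take values in {0,1}).
LinComb : Set
LinComb = List (ℕ × Word)

scale : ℕ → LinComb → LinComb
scale c = map (λ { (d , w) → (c * d , w) })

prefix : Letter → LinComb → LinComb
prefix x = map (λ { (d , w) → (d , x ∷ w) })

coeff : Word → LinComb → ℕ
coeff t [] = 0
coeff t ((c , s) ∷ rest) with t ≟W s
... | yes _ = c + coeff t rest
... | no  _ = coeff t rest

weakShuffle : (Letter → Letter → ℕ) → (Letter → Letter → ℕ) → Word → Word → LinComb
weakShuffle f₁ f₂ [] v = (1 , v) ∷ []
weakShuffle f₁ f₂ (x ∷ u) [] = (1 , x ∷ u) ∷ []
weakShuffle f₁ f₂ (x ∷ u) (y ∷ v) =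
  scale (f₁ x y) (prefix x (weakShuffle f₁ f₂ u (y ∷ v)))
  ++ scale (f₂ x y) (prefix y (weakShuffle f₁ f₂ (x ∷ u) v))

f₁⁹ : Letter → Letter → ℕ
f₁⁹ a a = 1
f₁⁹ a b = 1
f₁⁹ b a = 0
f₁⁹ b b = 1

f₂⁹ : Letter → Letter → ℕ
f₂⁹ a a = 1
f₂⁹ a b = 0
f₂⁹ b a = 1
f₂⁹ b b = 1

_□₉_ : Word → Word → LinComb
u □₉ v = weakShuffle f₁⁹ f₂⁹ u v

NonZeroLC : LinComb → Set
NonZeroLC p = ∃ λ t → ¬ (coeff t p ≡ 0)

{-# OPTIONS --safe #-}
module Submission where

-- All structure constants f₁, f₂ are natural numbers, so the terms of a
-- weak shuffle product never cancel. If at every pair of first letters at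
-- least one of f₁(x⊗y), f₂(x⊗y) is nonzero, the recursion
-- xu □ yv = f₁ x(u □ yv) + f₂ y(xu □ v) keeps a surviving term, and by
-- induction some word occurs in u □ v with positive coefficient. For □₉
-- this holds since f₁(x⊗y) + f₂(x⊗y) ≥ 1 for all letters.

open import Defs
open import Data.Nat using (ℕ; zero; suc)
open import Data.Nat.Properties using (m+n≡0⇒n≡0)
open import Data.Product using (_,_; ∃; map₂)
open import Data.List using ([]; _∷_; _++_)
open import Data.Sum using (_⊎_; inj₁; inj₂; [_,_])
open import Relation.Nullary using (yes; no; contradiction)
open import Relation.Binary.PropositionalEquality using (_≢_; refl)

infix 4 _∈⁺_

data _∈⁺_ (t : Word) : LinComb → Set where
  here  : ∀ {c r} → t ∈⁺ (suc c , t) ∷ r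
  there : ∀ {e r} → t ∈⁺ r → t ∈⁺ e ∷ r

∈⁺⇒coeff≢0 : ∀ {t p} → t ∈⁺ p → coeff t p ≢ 0
∈⁺⇒coeff≢0 {t} here with t ≟W t
... | yes _ = λ ()
... | no t≢t = contradiction refl t≢t
∈⁺⇒coeff≢0 {t} (there {c , s} t∈⁺r) with t ≟W s
... | yes _ = λ c+rest≡0 → ∈⁺⇒coeff≢0 t∈⁺r (m+n≡0⇒n≡0 c c+rest≡0)
... | no  _ = ∈⁺⇒coeff≢0 t∈⁺r

∈⁺-++⁺ˡ : ∀ {t p} q → t ∈⁺ p → t ∈⁺ p ++ q
∈⁺-++⁺ˡ q here         = here
∈⁺-++⁺ˡ q (there t∈⁺p) = there (∈⁺-++⁺ˡ q t∈⁺p)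

∈⁺-++⁺ʳ : ∀ {t} p {q} → t ∈⁺ q → t ∈⁺ p ++ q
∈⁺-++⁺ʳ []      t∈⁺q = t∈⁺q
∈⁺-++⁺ʳ (_ ∷ p) t∈⁺q = there (∈⁺-++⁺ʳ p t∈⁺q)

∈⁺-prefix⁺ : ∀ {t p} x → t ∈⁺ p → x ∷ t ∈⁺ prefix x p
∈⁺-prefix⁺ x here         = here
∈⁺-prefix⁺ x (there t∈⁺p) = there (∈⁺-prefix⁺ x t∈⁺p)

∈⁺-scale⁺ : ∀ {t p c} → c ≢ 0 → t ∈⁺ p → t ∈⁺ scale c p
∈⁺-scale⁺ {c = zero}  c≢0 _            = contradiction refl c≢0
∈⁺-scale⁺ {c = suc _} c≢0 here         = here
∈⁺-scale⁺ {c = suc _} c≢0 (there t∈⁺p) = there (∈⁺-scale⁺ c≢0 t∈⁺p)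

Nondegenerate : (Letter → Letter → ℕ) → (Letter → Letter → ℕ) → Set
Nondegenerate f₁ f₂ = ∀ x y → f₁ x y ≢ 0 ⊎ f₂ x y ≢ 0

module _ {f₁ f₂ : Letter → Letter → ℕ} where

  ∈⁺-weakShuffle-∷ˡ : ∀ {t x y} u v → f₁ x y ≢ 0 → t ∈⁺ weakShuffle f₁ f₂ u (y ∷ v) →
                      x ∷ t ∈⁺ weakShuffle f₁ f₂ (x ∷ u) (y ∷ v)
  ∈⁺-weakShuffle-∷ˡ {x = x} _ _ f₁xy≢0 t∈⁺ = ∈⁺-++⁺ˡ _ (∈⁺-scale⁺ f₁xy≢0 (∈⁺-prefix⁺ x t∈⁺))

  ∈⁺-weakShuffle-∷ʳ : ∀ {t x y} u v → f₂ x y ≢ 0 → t ∈⁺ weakShuffle f₁ f₂ (x ∷ u) v →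
                      y ∷ t ∈⁺ weakShuffle f₁ f₂ (x ∷ u) (y ∷ v)
  ∈⁺-weakShuffle-∷ʳ {y = y} _ _ f₂xy≢0 t∈⁺ = ∈⁺-++⁺ʳ _ (∈⁺-scale⁺ f₂xy≢0 (∈⁺-prefix⁺ y t∈⁺))

  weakShuffle-hasPositiveWord : Nondegenerate f₁ f₂ → ∀ u v → ∃ λ t → t ∈⁺ weakShuffle f₁ f₂ u v
  weakShuffle-hasPositiveWord nondeg []      v       = v , here
  weakShuffle-hasPositiveWord nondeg (x ∷ u) []      = x ∷ u , here
  weakShuffle-hasPositiveWord nondeg (x ∷ u) (y ∷ v) =
    [ (λ f₁xy≢0 → let t , t∈⁺ = weakShuffle-hasPositiveWord nondeg u (y ∷ v)
                  in x ∷ t , ∈⁺-weakShuffle-∷ˡ u v f₁xy≢0 t∈⁺)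
    , (λ f₂xy≢0 → let t , t∈⁺ = weakShuffle-hasPositiveWord nondeg (x ∷ u) v
                  in y ∷ t , ∈⁺-weakShuffle-∷ʳ u v f₂xy≢0 t∈⁺)
    ] (nondeg x y)

  weakShuffle-nonZero : Nondegenerate f₁ f₂ → ∀ u v → NonZeroLC (weakShuffle f₁ f₂ u v)
  weakShuffle-nonZero nondeg u v = map₂ ∈⁺⇒coeff≢0 (weakShuffle-hasPositiveWord nondeg u v)

□₉-nondegenerate : Nondegenerate f₁⁹ f₂⁹
□₉-nondegenerate a a = inj₁ λ ()
□₉-nondegenerate a b = inj₁ λ ()
□₉-nondegenerate b a = inj₂ λ ()
□₉-nondegenerate b b = inj₁ λ ()

mainTheorem1 : (v w : Word) → NonZeroLC (v □₉ w)
mainTheorem1 = weakShuffle-nonZero □₉-nondegenerate
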